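{- Let $\mathbf{A}=\langle A,\leq,\cdot,1,+,0\rangle$ be a commutative bimonoid (respectively commutative $\ell$-bimonoid). Let $L=R=A\times A$ and for $X\subseteq L$, $Y\subseteq R$ put $X^{\triangleright}=\{(c,d)\in R: a\cdot d\leq b+c \text{ for all }(a,b)\in X\}$ and $Y^{\triangleleft}=\{(a,b)\in L: a\cdot d\leq b+c\text{ for all }(c,d)\in Y\}$. Let $G$ be the set of all $X\subseteq L$ with $X=X^{\triangleright\triangleleft}$, ordered by inclusion, equipped with the operations $1^{G}=\{(1,0)\}^{\triangleright\triangleleft}$, $0^{G}=\{(0,1)\}^{\triangleleft}$, $X\cdot Y=\{(a\cdot c,b+d):(a,b)\in X,(c,d)\in Y\}^{\triangleright\triangleleft}$, $X+Y=\{(c+c',d\cdot d'):(c,d)\in X^{\triangleright},(c',d')\in Y^{\triangleright}\}^{\triangleleft}$, $X\wedge Y=X\cap Y$, $X\vee Y=(X\cup Y)^{\triangleright\triangleleft}$, and $\overline{X}=\{(b,a):(a,b)\in X\}^{\triangleleft}$. Then $G$ together with the map $a\mapsto\{(a,1)\}^{\triangleleft}=\{(c,d)\in A^2: c\leq d+a\}$ is a commutative complemented Dedekind--MacNeille completion of $\mathbf{A}$. In particular, every commutative (respectively commutative $\ell$-)bimonoid has a commutative complemented Dedekind--MacNeille completion.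
   Context: A bimonoid $\langle A,\leq,\cdot,1,+,0\rangle$ is a poset with two monoid structures ($\cdot$ with unit $1$, $+$ with unit $0$), both operations order preserving in each argument, satisfying hemidistributivity $x\cdot(y+z)\leq(x\cdot y)+z$ and $(z+y)\cdot x\leq z+(y\cdot x)$; commutative if both operations are commutative. A commutative $\ell$-bimonoid is a commutative bimonoid whose order is a lattice such that $x\cdot(y\vee z)=(x\cdot y)\vee(x\cdot z)$ and $x+(y\wedge z)=(x+y)\wedge(x+z)$. Homomorphisms preserve order, $\cdot,1,+,0$; embeddings are homomorphisms that are order embeddings. In a commutative bimonoid, $y$ is a complement of $x$ if $x\cdot y\leq 0$ and $1\leq x+y$; unique if it exists, written $\overline{x}$; complemented means every element has a complement; complete means the order is a complete lattice. An embedding $e\colon\mathbf{A}\hookrightarrow\mathbf{C}$ of commutative bimonoids is a commutative $\Delta_1$-extension if the elements $e(a)\cdot\overline{e(b)}$ ($a,b\in\mathbf{A}$, complement existing in $\mathbf{C}$) are join dense and the elements $e(a)+\overline{e(b)}$ are meet dense in $\mathbf{C}$. A commutative complemented Dedekind--MacNeille completion of $\mathbf{A}$ is a commutative $\Delta_1$-extension $e\colon\mathbf{A}\hookrightarrow\mathbf{C}$ with $\mathbf{C}$ complete and complemented. -}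

module Defs where

open import Level using (Level; _⊔_; suc)
open import Data.Product using (Σ; Σ-syntax; ∃; ∃-syntax; _×_; _,_; proj₁; proj₂)
open import Data.Sum using (_⊎_; inj₁; inj₂)
open import Relation.Binary.Core using (Rel; _Preserves₂_⟶_⟶_)
open import Relation.Binary.Structures using (IsPartialOrder)
open import Relation.Binary.Lattice.Structures using (IsLattice)
open import Relation.Binary.PropositionalEquality using (_≡_)
open import Algebra.Core using (Op₂)
open import Algebra.Structures using (IsCommutativeMonoid)
open import Relation.Unary using (Pred; _⊆_; _∩_; _∪_)

record IsCommBimonoid {c ℓ₁ ℓ₂} {C : Set c} (_≈_ : Rel C ℓ₁) (_≤_ : Rel C ℓ₂)
                      (_·_ : Op₂ C) (1# : C) (_+_ : Op₂ C) (0# : C)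
                      : Set (c ⊔ ℓ₁ ⊔ ℓ₂) where
  field
    isPartialOrder   : IsPartialOrder _≈_ _≤_
    ·-isCommMonoid   : IsCommutativeMonoid _≈_ _·_ 1#
    +-isCommMonoid   : IsCommutativeMonoid _≈_ _+_ 0#
    ·-mono           : _·_ Preserves₂ _≤_ ⟶ _≤_ ⟶ _≤_
    +-mono           : _+_ Preserves₂ _≤_ ⟶ _≤_ ⟶ _≤_
    hemidistribˡ     : ∀ x y z → (x · (y + z)) ≤ ((x · y) + z)
    hemidistribʳ     : ∀ x y z → ((z + y) · x) ≤ (z + (y · x))

record CommBimonoid c ℓ₁ ℓ₂ : Set (suc (c ⊔ ℓ₁ ⊔ ℓ₂)) where
  infixl 7 _·_
  infixl 6 _+_
  infix 4 _≈_ _≤_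
  field
    Carrier        : Set c
    _≈_            : Rel Carrier ℓ₁
    _≤_            : Rel Carrier ℓ₂
    _·_            : Op₂ Carrier
    1#             : Carrier
    _+_            : Op₂ Carrier
    0#             : Carrier
    isCommBimonoid : IsCommBimonoid _≈_ _≤_ _·_ 1# _+_ 0#
  open IsCommBimonoid isCommBimonoid public

record IsℓExtension {c ℓ₁ ℓ₂} (A : CommBimonoid c ℓ₁ ℓ₂)
                    (_∨_ _∧_ : Op₂ (CommBimonoid.Carrier A)) : Set (c ⊔ ℓ₁ ⊔ ℓ₂) where
  open CommBimonoid A
  field
    isLattice  : IsLattice _≈_ _≤_ _∨_ _∧_
    ·-distrib-∨ : ∀ x y z → x · (y ∨ z) ≈ (x · y) ∨ (x · z)
    +-distrib-∧ : ∀ x y z → x + (y ∧ z) ≈ (x + y) ∧ (x + z)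

record ℓExtension {c ℓ₁ ℓ₂} (A : CommBimonoid c ℓ₁ ℓ₂) : Set (c ⊔ ℓ₁ ⊔ ℓ₂) where
  field
    _∨_ _∧_     : Op₂ (CommBimonoid.Carrier A)
    isℓExtension : IsℓExtension A _∨_ _∧_
  open IsℓExtension isℓExtension public

module _ {a b ℓ₁ ℓ₂ m₁ m₂} (A : CommBimonoid a ℓ₁ ℓ₂) (B : CommBimonoid b m₁ m₂) where
  private
    module A = CommBimonoid A
    module B = CommBimonoid B

  record IsHomomorphism (f : A.Carrier → B.Carrier) : Set (a ⊔ ℓ₂ ⊔ m₁ ⊔ m₂) where
    field
      mono   : ∀ {x y} → x A.≤ y → f x B.≤ f y
      ·-hom  : ∀ x y → f (x A.· y) B.≈ f x B.· f y
      1-hom  : f A.1# B.≈ B.1#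
      +-hom  : ∀ x y → f (x A.+ y) B.≈ f x B.+ f y
      0-hom  : f A.0# B.≈ B.0#

  record IsEmbedding (f : A.Carrier → B.Carrier) : Set (a ⊔ ℓ₂ ⊔ m₁ ⊔ m₂) where
    field
      isHomomorphism : IsHomomorphism f
      order-reflect  : ∀ {x y} → f x B.≤ f y → x A.≤ y

module _ {c ℓ₁ ℓ₂} (C : CommBimonoid c ℓ₁ ℓ₂) where
  open CommBimonoid C

  IsComplement : Carrier → Carrier → Set ℓ₂
  IsComplement x y = (x · y ≤ 0#) × (1# ≤ x + y)

  IsComplemented : Set (c ⊔ ℓ₂)
  IsComplemented = ∀ x → ∃[ y ] IsComplement x y

  IsSup : ∀ {i} {I : Set i} → (I → Carrier) → Carrier → Set (i ⊔ c ⊔ ℓ₂)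
  IsSup f s = (∀ j → f j ≤ s) × (∀ u → (∀ j → f j ≤ u) → s ≤ u)

  IsInf : ∀ {i} {I : Set i} → (I → Carrier) → Carrier → Set (i ⊔ c ⊔ ℓ₂)
  IsInf f s = (∀ j → s ≤ f j) × (∀ u → (∀ j → u ≤ f j) → u ≤ s)

  IsComplete : ∀ i → Set (suc i ⊔ c ⊔ ℓ₂)
  IsComplete i = ∀ (I : Set i) (f : I → Carrier) →
                   (∃[ s ] IsSup f s) × (∃[ s ] IsInf f s)

module _ {a b ℓ₁ ℓ₂ m₁ m₂} (A : CommBimonoid a ℓ₁ ℓ₂) (C : CommBimonoid b m₁ m₂) where
  private
    module A = CommBimonoid A
  open CommBimonoid C

  -- elements e(a)·ȳ with ȳ the complement of e(b) are join dense,
  -- i.e. every x is the join of those of them lying below x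
  JoinDense : (A.Carrier → Carrier) → Set (a ⊔ b ⊔ m₂)
  JoinDense e = ∀ x z →
    (∀ p q y → IsComplement C (e q) y → e p · y ≤ x → e p · y ≤ z) → x ≤ z

  -- elements e(a)+ȳ with ȳ the complement of e(b) are meet dense
  MeetDense : (A.Carrier → Carrier) → Set (a ⊔ b ⊔ m₂)
  MeetDense e = ∀ x z →
    (∀ p q y → IsComplement C (e q) y → x ≤ e p + y → z ≤ e p + y) → z ≤ x

  record IsΔ₁Extension (e : A.Carrier → Carrier) : Set (a ⊔ b ⊔ ℓ₂ ⊔ m₁ ⊔ m₂) where
    field
      isEmbedding : IsEmbedding A C e
      joinDense   : JoinDense e
      meetDense   : MeetDense e

  record IsComplementedDMCompletion i (e : A.Carrier → Carrier)
         : Set (suc i ⊔ a ⊔ b ⊔ ℓ₂ ⊔ m₁ ⊔ m₂) where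
    field
      isΔ₁Extension  : IsΔ₁Extension e
      complete       : IsComplete C i
      complemented   : IsComplemented C

module Construction {c ℓ₁ ℓ₂} (A : CommBimonoid c ℓ₁ ℓ₂) where
  open CommBimonoid A

  p : Level
  p = c ⊔ ℓ₂

  A² : Set c
  A² = Carrier × Carrier

  _▷ : ∀ {ℓ} → Pred A² ℓ → Pred A² (c ⊔ ℓ₂ ⊔ ℓ)
  (X ▷) (c' , d) = ∀ {a b} → X (a , b) → a · d ≤ b + c'

  _◁ : ∀ {ℓ} → Pred A² ℓ → Pred A² (c ⊔ ℓ₂ ⊔ ℓ)
  (Y ◁) (a , b) = ∀ {c' d} → Y (c' , d) → a · d ≤ b + c'

  ▷-antitone : ∀ {ℓ ℓ'} {X : Pred A² ℓ} {Y : Pred A² ℓ'} → X ⊆ Y → Y ▷ ⊆ X ▷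
  ▷-antitone X⊆Y h x = h (X⊆Y x)

  ◁-antitone : ∀ {ℓ ℓ'} {X : Pred A² ℓ} {Y : Pred A² ℓ'} → X ⊆ Y → Y ◁ ⊆ X ◁
  ◁-antitone X⊆Y h x = h (X⊆Y x)

  ⊆▷◁ : ∀ {ℓ} {X : Pred A² ℓ} → X ⊆ (X ▷) ◁
  ⊆▷◁ x h = h x

  ⊆◁▷ : ∀ {ℓ} {Y : Pred A² ℓ} → Y ⊆ (Y ◁) ▷
  ⊆◁▷ y h = h y

  Closed : Pred A² p → Set p
  Closed X = (X ⊆ (X ▷) ◁) × ((X ▷) ◁ ⊆ X)

  G : Set (suc p)
  G = Σ (Pred A² p) Closed

  ◁-closed : (Y : Pred A² p) → Closed (Y ◁)
  ◁-closed Y = ⊆▷◁ , ◁-antitone (⊆◁▷ {Y = Y})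

  ⟦_⟧ : G → Pred A² p
  ⟦_⟧ = proj₁

  _≐_ : Rel G p
  X ≐ Y = (⟦ X ⟧ ⊆ ⟦ Y ⟧) × (⟦ Y ⟧ ⊆ ⟦ X ⟧)

  _⊑_ : Rel G p
  X ⊑ Y = ⟦ X ⟧ ⊆ ⟦ Y ⟧

  ◁G : Pred A² p → G
  ◁G Y = (Y ◁) , ◁-closed Y

  cl : Pred A² p → G
  cl X = ◁G (X ▷)

  ⟨_⟩ : A² → Pred A² p
  ⟨ z ⟩ w = Level.Lift p (w ≡ z)

  1G : G
  1G = cl ⟨ 1# , 0# ⟩

  0G : G
  0G = ◁G ⟨ 0# , 1# ⟩

  _·G_ : G → G → G
  X ·G Y = cl (λ z → ∃[ a ] ∃[ b ] ∃[ c' ] ∃[ d ]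
                 ⟦ X ⟧ (a , b) × ⟦ Y ⟧ (c' , d) × z ≡ (a · c' , b + d))

  _+G_ : G → G → G
  X +G Y = ◁G (λ z → ∃[ c' ] ∃[ d ] ∃[ c'' ] ∃[ d' ]
                 (⟦ X ⟧ ▷) (c' , d) × (⟦ Y ⟧ ▷) (c'' , d') × z ≡ (c' + c'' , d · d'))

  _∧G_ : G → G → G
  X ∧G Y = (⟦ X ⟧ ∩ ⟦ Y ⟧) , ⊆▷◁ , λ h →
    proj₂ (proj₂ X) (λ {c'} {d} x → h (λ {a} {b} (xa , _) → x xa))
    , proj₂ (proj₂ Y) (λ {c'} {d} y → h (λ {a} {b} (_ , ya) → y ya))

  _∨G_ : G → G → G
  X ∨G Y = cl (⟦ X ⟧ ∪ ⟦ Y ⟧)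

  compG : G → G
  compG X = ◁G (λ { (b , a) → ⟦ X ⟧ (a , b) })

  eG : Carrier → G
  eG x = ◁G ⟨ x , 1# ⟩

  GBimonoid : IsCommBimonoid _≐_ _⊑_ _·G_ 1G _+G_ 0G → CommBimonoid (suc p) p p
  GBimonoid isB = record { isCommBimonoid = isB }

-- Pairs in A × A form a commutative monoid under (a , b) ⊗ (c , d) = (a · c , b + d), and ▷, ◁
-- are the two polars of the relation (a , b) ⊲ (c , d) :⇔ a · d ≤ b + c.  Associativity and
-- commutativity of A make ⊲ compatible with ⊗, so, as in the phase semantics of linear logic,
-- Galois closure is a nucleus (cl P ⊗ cl Q ⊆ cl (P ⊗ Q), and dually for ⊕).  Hence the closed
-- sets form a complete lattice on which · and its De Morgan dual + are commutative monoids
-- satisfying hemidistributivity, and the polar of the swapped set is a complement.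
-- Hemidistributivity of A is used only in ⊲-cut: it shows that e x is the closure of the point
-- (x , 0) and its complement that of (1 , x).  So the closure of a point (a , b) is e a · ē b and
-- the polar of a point (c , d) is e c + ē d, which gives join and meet density.

{-# OPTIONS --safe #-}
module Submission where

open import Level using (Lift; lift) renaming (suc to lsuc)
open import Data.Product using (Σ-syntax; ∃-syntax; _×_; _,_; proj₁; proj₂)
open import Data.Sum using (inj₁; inj₂)
open import Relation.Binary.Core using (Rel; _Preserves₂_⟶_⟶_)
open import Relation.Binary.Bundles using (Poset; Setoid)
open import Relation.Binary.Structures using (IsPartialOrder; IsEquivalence)
open import Relation.Binary.Lattice.Structures using (IsLattice)
open import Relation.Binary.PropositionalEquality using (_≡_; refl)
open import Relation.Unary using (Pred; _⊆_; _∪_)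
open import Algebra.Structures using (IsCommutativeMonoid)
import Algebra.Structures.Biased as Biased
import Relation.Binary.Reasoning.PartialOrder as PosetReasoning
import Relation.Binary.Reasoning.Setoid as SetoidReasoning
open import Defs

module _ {a ℓ₁ ℓ₂} {C : Set a} {_≈_ : Rel C ℓ₁} {_≤_ : Rel C ℓ₂}
         (isPartialOrder : IsPartialOrder _≈_ _≤_) where
  open IsPartialOrder isPartialOrder using (antisym; reflexive; isEquivalence; module Eq)
    renaming (refl to ≤-refl)

  private
    poset : Poset a ℓ₁ ℓ₂
    poset = record { isPartialOrder = isPartialOrder }

  open PosetReasoning poset

  comm∧assoc∧idˡ⇒isCommutativeMonoid :
    ∀ {_∙_ ε} → _∙_ Preserves₂ _≤_ ⟶ _≤_ ⟶ _≤_ →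
    (∀ x y → (x ∙ y) ≤ (y ∙ x)) →
    (∀ x y z → ((x ∙ y) ∙ z) ≤ (x ∙ (y ∙ z))) →
    (∀ x → (ε ∙ x) ≤ x) → (∀ x → x ≤ (ε ∙ x)) →
    IsCommutativeMonoid _≈_ _∙_ ε
  comm∧assoc∧idˡ⇒isCommutativeMonoid {_∙_} {ε} mono comm assoc idˡ idˡ⁻ =
    Biased.isCommutativeMonoidˡ record
      { isSemigroup = record
        { isMagma = record
          { isEquivalence = isEquivalence
          ; ∙-cong        = λ x≈y u≈v →
              antisym (mono (reflexive x≈y) (reflexive u≈v))
                      (mono (reflexive (Eq.sym x≈y)) (reflexive (Eq.sym u≈v)))
          }
        ; assoc = λ x y z → antisym (assoc x y z) (assoc⁻ x y z)
        }
      ; identityˡ = λ x → antisym (idˡ x) (idˡ⁻ x)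
      ; comm      = λ x y → antisym (comm x y) (comm y x)
      }
    where
    assoc⁻ : ∀ x y z → (x ∙ (y ∙ z)) ≤ ((x ∙ y) ∙ z)
    assoc⁻ x y z = begin
      x ∙ (y ∙ z)  ≤⟨ comm x (y ∙ z) ⟩
      (y ∙ z) ∙ x  ≤⟨ assoc y z x ⟩
      y ∙ (z ∙ x)  ≤⟨ comm y (z ∙ x) ⟩
      (z ∙ x) ∙ y  ≤⟨ assoc z x y ⟩
      z ∙ (x ∙ y)  ≤⟨ comm z (x ∙ y) ⟩
      (x ∙ y) ∙ z  ∎

  hemidistribˡ∧comm⇒hemidistribʳ :
    ∀ {_·_ _+_} → _·_ Preserves₂ _≤_ ⟶ _≤_ ⟶ _≤_ → _+_ Preserves₂ _≤_ ⟶ _≤_ ⟶ _≤_ →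
    (∀ x y → (x · y) ≤ (y · x)) → (∀ x y → (x + y) ≤ (y + x)) →
    (∀ x y z → (x · (y + z)) ≤ ((x · y) + z)) →
    ∀ x y z → ((z + y) · x) ≤ (z + (y · x))
  hemidistribˡ∧comm⇒hemidistribʳ {_·_} {_+_} ·-mono +-mono ·-comm +-comm hemi x y z = begin
    (z + y) · x  ≤⟨ ·-comm (z + y) x ⟩
    x · (z + y)  ≤⟨ ·-mono ≤-refl (+-comm z y) ⟩
    x · (y + z)  ≤⟨ hemi x y z ⟩
    (x · y) + z  ≤⟨ +-comm (x · y) z ⟩
    z + (x · y)  ≤⟨ +-mono ≤-refl (·-comm x y) ⟩
    z + (y · x)  ∎

module Completion {c ℓ₁ ℓ₂} (A : CommBimonoid c ℓ₁ ℓ₂) where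
  open CommBimonoid A
  open Construction A
  open IsPartialOrder isPartialOrder
    using (≤-respˡ-≈; ≤-respʳ-≈)
    renaming (refl to ≤-refl; trans to ≤-trans; isEquivalence to ≈-isEquivalence)
  open IsEquivalence ≈-isEquivalence using () renaming (refl to ≈-refl; sym to ≈-sym)
  module · = IsCommutativeMonoid ·-isCommMonoid
  module + = IsCommutativeMonoid +-isCommMonoid

  private
    poset : Poset c ℓ₁ ℓ₂
    poset = record { isPartialOrder = isPartialOrder }

  module ≤-Reasoning = PosetReasoning poset

  private
    variable
      a a' b b' u u' v v' x y : Carrier

  ≤-resp₂ : a ≈ a' → b ≈ b' → a ≤ b → a' ≤ b'
  ≤-resp₂ a≈a' b≈b' a≤b = ≤-respʳ-≈ b≈b' (≤-respˡ-≈ a≈a' a≤b)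

  infix 4 _⊲_
  _⊲_ : A² → A² → Set ℓ₂
  (a , b) ⊲ (u , v) = a · v ≤ b + u

  ⊲-resp-≈ : a ≈ a' → b ≈ b' → u ≈ u' → v ≈ v' → (a , b) ⊲ (u , v) → (a' , b') ⊲ (u' , v')
  ⊲-resp-≈ a≈a' b≈b' u≈u' v≈v' = ≤-resp₂ (·.∙-cong a≈a' v≈v') (+.∙-cong b≈b' u≈u')

  ⊲-flip : (a , b) ⊲ (u , v) → (v , u) ⊲ (b , a)
  ⊲-flip = ≤-resp₂ (·.comm _ _) (+.comm _ _)

  ⊲-commˡ : (a · a' , b + b') ⊲ (u , v) → (a' · a , b' + b) ⊲ (u , v)
  ⊲-commˡ = ⊲-resp-≈ (·.comm _ _) (+.comm _ _) ≈-refl ≈-refl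

  ⊲-commʳ : (a , b) ⊲ (u + u' , v · v') → (a , b) ⊲ (u' + u , v' · v)
  ⊲-commʳ = ⊲-resp-≈ ≈-refl ≈-refl (+.comm _ _) (·.comm _ _)

  ⊲-assoc : (a · a' , b + b') ⊲ (u , v) → (a , b) ⊲ (b' + u , a' · v)
  ⊲-assoc = ≤-resp₂ (·.assoc _ _ _) (+.assoc _ _ _)

  ⊲-assoc⁻ : (a , b) ⊲ (b' + u , a' · v) → (a · a' , b + b') ⊲ (u , v)
  ⊲-assoc⁻ = ≤-resp₂ (≈-sym (·.assoc _ _ _)) (≈-sym (+.assoc _ _ _))

  ⊲-cut : ∀ {a b x u v} → (a , b) ⊲ (x , 1#) → (x , 0#) ⊲ (u , v) → (a , b) ⊲ (u , v)
  ⊲-cut {a} {b} {x} {u} {v} ab⊲x x⊲uv = begin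
    a · v         ≈⟨ ·.∙-congʳ (·.identityʳ a) ⟨
    a · 1# · v    ≤⟨ ·-mono ab⊲x ≤-refl ⟩
    (b + x) · v   ≤⟨ hemidistribʳ v x b ⟩
    b + x · v     ≤⟨ +-mono ≤-refl x⊲uv ⟩
    b + (0# + u)  ≈⟨ +.∙-congˡ (+.identityˡ u) ⟩
    b + u         ∎
    where open ≤-Reasoning

  closed : (X : G) → (⟦ X ⟧ ▷) ◁ ⊆ ⟦ X ⟧
  closed X = proj₂ (proj₂ X)

  ∈-resp-≈ : (X : G) → ⟦ X ⟧ (a , b) → a ≈ a' → b ≈ b' → ⟦ X ⟧ (a' , b')
  ∈-resp-≈ X x a≈a' b≈b' = closed X λ w → ⊲-resp-≈ a≈a' b≈b' ≈-refl ≈-refl (w x)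

  ▷-resp-≈ : ∀ {ℓ} (P : Pred A² ℓ) → (P ▷) (u , v) → u ≈ u' → v ≈ v' → (P ▷) (u' , v')
  ▷-resp-≈ P w u≈u' v≈v' x = ⊲-resp-≈ ≈-refl ≈-refl u≈u' v≈v' (w x)

  cl-least : (P : Pred A² p) (X : G) → P ⊆ ⟦ X ⟧ → cl P ⊑ X
  cl-least P X P⊆X x = closed X (◁-antitone (▷-antitone P⊆X) x)

  ≐-isEquivalence : IsEquivalence _≐_
  ≐-isEquivalence = record
    { refl  = (λ x → x) , (λ x → x)
    ; sym   = λ (f , g) → g , f
    ; trans = λ (f , g) (f' , g') → (λ x → f' (f x)) , (λ x → g (g' x))
    }

  ≐-setoid : Setoid (lsuc p) p
  ≐-setoid = record { isEquivalence = ≐-isEquivalence }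

  module ≐-Reasoning = SetoidReasoning ≐-setoid

  ⊑-isPartialOrder : IsPartialOrder _≐_ _⊑_
  ⊑-isPartialOrder = record
    { isPreorder = record
      { isEquivalence = ≐-isEquivalence
      ; reflexive     = proj₁
      ; trans         = λ f g x → g (f x)
      }
    ; antisym = _,_
    }

  infixl 7 _⊗_
  infixl 6 _⊕_

  _⊗_ : Pred A² p → Pred A² p → Pred A² p
  (P ⊗ Q) z = ∃[ a ] ∃[ b ] ∃[ a' ] ∃[ b' ] P (a , b) × Q (a' , b') × z ≡ (a · a' , b + b')

  _⊕_ : Pred A² p → Pred A² p → Pred A² p
  (P ⊕ Q) z = ∃[ u ] ∃[ v ] ∃[ u' ] ∃[ v' ] P (u , v) × Q (u' , v') × z ≡ (u + u' , v · v')

  mk⊗ : {P Q : Pred A² p} → P (a , b) → Q (a' , b') → (P ⊗ Q) (a · a' , b + b')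
  mk⊗ x y = _ , _ , _ , _ , x , y , refl

  mk⊕ : {P Q : Pred A² p} → P (u , v) → Q (u' , v') → (P ⊕ Q) (u + u' , v · v')
  mk⊕ x y = _ , _ , _ , _ , x , y , refl

  cl-⊗ˡ-⊆ : {P Q : Pred A² p} (W : G) → P ⊗ Q ⊆ ⟦ W ⟧ → ⟦ cl P ⟧ ⊗ Q ⊆ ⟦ W ⟧
  cl-⊗ˡ-⊆ W P⊗Q⊆W (_ , _ , _ , _ , x , y , refl) =
    closed W λ w → ⊲-assoc⁻ (x λ x' → ⊲-assoc (w (P⊗Q⊆W (mk⊗ x' y))))

  cl-⊗ʳ-⊆ : {P Q : Pred A² p} (W : G) → P ⊗ Q ⊆ ⟦ W ⟧ → P ⊗ ⟦ cl Q ⟧ ⊆ ⟦ W ⟧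
  cl-⊗ʳ-⊆ W P⊗Q⊆W (_ , _ , _ , _ , x , y , refl) =
    closed W λ w → ⊲-commˡ (⊲-assoc⁻ (y λ y' → ⊲-assoc (⊲-commˡ (w (P⊗Q⊆W (mk⊗ x y'))))))

  cl-⊗-⊆ : {P Q : Pred A² p} (W : G) → P ⊗ Q ⊆ ⟦ W ⟧ → ⟦ cl P ⟧ ⊗ ⟦ cl Q ⟧ ⊆ ⟦ W ⟧
  cl-⊗-⊆ W P⊗Q⊆W = cl-⊗ˡ-⊆ W (cl-⊗ʳ-⊆ W P⊗Q⊆W)

  ◁▷-⊕ˡ-⊆ : {P Q : Pred A² p} (S : Pred A² p) → P ⊕ Q ⊆ S ▷ → (P ◁) ▷ ⊕ Q ⊆ S ▷
  ◁▷-⊕ˡ-⊆ S P⊕Q⊆S▷ (_ , _ , _ , _ , x , y , refl) s =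
    ⊲-commʳ (⊲-assoc (x λ x' → ⊲-assoc⁻ (⊲-commʳ (P⊕Q⊆S▷ (mk⊕ x' y) s))))

  ◁▷-⊕ʳ-⊆ : {P Q : Pred A² p} (S : Pred A² p) → P ⊕ Q ⊆ S ▷ → P ⊕ (Q ◁) ▷ ⊆ S ▷
  ◁▷-⊕ʳ-⊆ S P⊕Q⊆S▷ (_ , _ , _ , _ , x , y , refl) s =
    ⊲-assoc (y λ y' → ⊲-assoc⁻ (P⊕Q⊆S▷ (mk⊕ x y') s))

  ◁▷-⊕-⊆ : {P Q : Pred A² p} (S : Pred A² p) → P ⊕ Q ⊆ S ▷ → (P ◁) ▷ ⊕ (Q ◁) ▷ ⊆ S ▷
  ◁▷-⊕-⊆ S P⊕Q⊆S▷ = ◁▷-⊕ˡ-⊆ S (◁▷-⊕ʳ-⊆ S P⊕Q⊆S▷)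

  ∈·G : (X Y : G) → ⟦ X ⟧ (a , b) → ⟦ Y ⟧ (a' , b') → ⟦ X ·G Y ⟧ (a · a' , b + b')
  ∈·G X Y x y = ⊆▷◁ (mk⊗ x y)

  ·G-least : (X Y W : G) → ⟦ X ⟧ ⊗ ⟦ Y ⟧ ⊆ ⟦ W ⟧ → (X ·G Y) ⊑ W
  ·G-least X Y = cl-least (⟦ X ⟧ ⊗ ⟦ Y ⟧)

  ∈+G▷ : (X Y : G) → (⟦ X ⟧ ▷) (u , v) → (⟦ Y ⟧ ▷) (u' , v') → (⟦ X +G Y ⟧ ▷) (u + u' , v · v')
  ∈+G▷ X Y x y = ⊆◁▷ (mk⊕ {P = ⟦ X ⟧ ▷} {Q = ⟦ Y ⟧ ▷} x y)

  +G-greatest : (X Y W : G) → ⟦ X ⟧ ▷ ⊕ ⟦ Y ⟧ ▷ ⊆ ⟦ W ⟧ ▷ → W ⊑ (X +G Y)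
  +G-greatest X Y W ⊕⊆W▷ w z = ⊕⊆W▷ z w

  ·G-mono : _·G_ Preserves₂ _⊑_ ⟶ _⊑_ ⟶ _⊑_
  ·G-mono {X} {X'} {Y} {Y'} X⊑X' Y⊑Y' = ·G-least X Y (X' ·G Y') λ where
    (_ , _ , _ , _ , x , y , refl) → ∈·G X' Y' (X⊑X' x) (Y⊑Y' y)

  +G-mono : _+G_ Preserves₂ _⊑_ ⟶ _⊑_ ⟶ _⊑_
  +G-mono {X} {X'} {Y} {Y'} X⊑X' Y⊑Y' = +G-greatest X' Y' (X +G Y) λ where
    (_ , _ , _ , _ , x , y , refl) → ∈+G▷ X Y (▷-antitone X⊑X' x) (▷-antitone Y⊑Y' y)

  ·G-comm : ∀ X Y → (X ·G Y) ⊑ (Y ·G X)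
  ·G-comm X Y = ·G-least X Y (Y ·G X) λ where
    (a , b , a' , b' , x , y , refl) → ∈-resp-≈ (Y ·G X) (∈·G Y X y x) (·.comm a' a) (+.comm b' b)

  +G-comm : ∀ X Y → (X +G Y) ⊑ (Y +G X)
  +G-comm X Y = +G-greatest Y X (X +G Y) λ where
    (u , v , u' , v' , y , x , refl) →
      ▷-resp-≈ ⟦ X +G Y ⟧ (∈+G▷ X Y x y) (+.comm u' u) (·.comm v' v)

  ·G-assoc : ∀ X Y Z → ((X ·G Y) ·G Z) ⊑ (X ·G (Y ·G Z))
  ·G-assoc X Y Z = ·G-least (X ·G Y) Z W (cl-⊗ˡ-⊆ W λ where
    (_ , _ , a'' , b'' , (a , b , a' , b' , x , y , refl) , z , refl) →
      ∈-resp-≈ W (∈·G X (Y ·G Z) x (∈·G Y Z y z))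
               (≈-sym (·.assoc a a' a'')) (≈-sym (+.assoc b b' b'')))
    where W = X ·G (Y ·G Z)

  +G-assoc : ∀ X Y Z → ((X +G Y) +G Z) ⊑ (X +G (Y +G Z))
  +G-assoc X Y Z = +G-greatest X (Y +G Z) ((X +G Y) +G Z) (◁▷-⊕ʳ-⊆ S λ where
    (u , v , _ , _ , x , (u' , v' , u'' , v'' , y , z , refl) , refl) →
      ▷-resp-≈ S (∈+G▷ (X +G Y) Z (∈+G▷ X Y x y) z) (+.assoc u u' u'') (·.assoc v v' v''))
    where S = ⟦ (X +G Y) +G Z ⟧

  ·G-identityˡ : ∀ X → (1G ·G X) ⊑ X
  ·G-identityˡ X = ·G-least 1G X X (cl-⊗ˡ-⊆ X λ where
    (_ , _ , a , b , lift refl , x , refl) →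
      ∈-resp-≈ X x (≈-sym (·.identityˡ a)) (≈-sym (+.identityˡ b)))

  ·G-identityˡ⁻ : ∀ X → X ⊑ (1G ·G X)
  ·G-identityˡ⁻ X x =
    ∈-resp-≈ (1G ·G X) (∈·G 1G X (⊆▷◁ (lift refl)) x) (·.identityˡ _) (+.identityˡ _)

  +G-identityˡ : ∀ X → (0G +G X) ⊑ X
  +G-identityˡ X z = closed X λ w →
    ⊲-resp-≈ ≈-refl ≈-refl (+.identityˡ _) (·.identityˡ _)
      (z (mk⊕ {P = ⟦ 0G ⟧ ▷} {Q = ⟦ X ⟧ ▷} (⊆◁▷ (lift refl)) w))

  +G-identityˡ⁻ : ∀ X → X ⊑ (0G +G X)
  +G-identityˡ⁻ X = +G-greatest 0G X X (◁▷-⊕ˡ-⊆ ⟦ X ⟧ λ where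
    (_ , _ , u , v , lift refl , w , refl) →
      ▷-resp-≈ ⟦ X ⟧ w (≈-sym (+.identityˡ u)) (≈-sym (·.identityˡ v)))

  ·G-residual : (X Y : G) → (⟦ X ·G Y ⟧ ▷) (u , v) → ⟦ X ⟧ (a , b) →
                (⟦ Y ⟧ ▷) (b + u , a · v)
  ·G-residual X Y w x y = ⊲-assoc (⊲-commˡ (w (∈·G X Y x y)))

  ·G-hemidistribˡ : ∀ X Y Z → (X ·G (Y +G Z)) ⊑ ((X ·G Y) +G Z)
  ·G-hemidistribˡ X Y Z = ·G-least X (Y +G Z) ((X ·G Y) +G Z) λ where
    (_ , _ , _ , _ , x , yz , refl) (_ , _ , _ , _ , w , z , refl) →
      ⊲-commˡ (⊲-assoc⁻ (⊲-resp-≈ ≈-refl ≈-refl (+.assoc _ _ _) (·.assoc _ _ _)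
        (yz (mk⊕ {P = ⟦ Y ⟧ ▷} {Q = ⟦ Z ⟧ ▷} (·G-residual X Y w x) z))))

  -- ⟦_⟧ is not injective, so the implicit arguments of ·G-mono and +G-mono
  -- cannot be inferred and are passed on explicitly.
  G-isCommBimonoid : IsCommBimonoid _≐_ _⊑_ _·G_ 1G _+G_ 0G
  G-isCommBimonoid = record
    { isPartialOrder = ⊑-isPartialOrder
    ; ·-isCommMonoid = comm∧assoc∧idˡ⇒isCommutativeMonoid ⊑-isPartialOrder
        (λ {X} {X'} {Y} {Y'} → ·G-mono {X} {X'} {Y} {Y'})
        ·G-comm ·G-assoc ·G-identityˡ ·G-identityˡ⁻
    ; +-isCommMonoid = comm∧assoc∧idˡ⇒isCommutativeMonoid ⊑-isPartialOrder
        (λ {X} {X'} {Y} {Y'} → +G-mono {X} {X'} {Y} {Y'})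
        +G-comm +G-assoc +G-identityˡ +G-identityˡ⁻
    ; ·-mono         = λ {X} {X'} {Y} {Y'} → ·G-mono {X} {X'} {Y} {Y'}
    ; +-mono         = λ {X} {X'} {Y} {Y'} → +G-mono {X} {X'} {Y} {Y'}
    ; hemidistribˡ   = ·G-hemidistribˡ
    ; hemidistribʳ   = hemidistribˡ∧comm⇒hemidistribʳ ⊑-isPartialOrder {_·G_} {_+G_}
        (λ {X} {X'} {Y} {Y'} → ·G-mono {X} {X'} {Y} {Y'})
        (λ {X} {X'} {Y} {Y'} → +G-mono {X} {X'} {Y} {Y'})
        ·G-comm +G-comm ·G-hemidistribˡ
    }

  G-commBimonoid : CommBimonoid (lsuc p) p p
  G-commBimonoid = GBimonoid G-isCommBimonoid

  open IsCommutativeMonoid (IsCommBimonoid.·-isCommMonoid G-isCommBimonoid)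
    using () renaming (∙-cong to ·G-cong)
  open IsCommutativeMonoid (IsCommBimonoid.+-isCommMonoid G-isCommBimonoid)
    using () renaming (∙-cong to +G-cong)
  open IsEquivalence ≐-isEquivalence using () renaming (refl to ≐-refl)

  ▷⇒compG : (X : G) → (⟦ X ⟧ ▷) (u , v) → ⟦ compG X ⟧ (v , u)
  ▷⇒compG X w x = ⊲-flip (w x)

  compG-isComplement : ∀ X → IsComplement G-commBimonoid X (compG X)
  compG-isComplement X = X·X̄⊑0 , 1⊑X+X̄
    where
    X·X̄⊑0 : (X ·G compG X) ⊑ 0G
    X·X̄⊑0 = ·G-least X (compG X) 0G λ where
      (a , b , _ , _ , x , x̄ , refl) (lift refl) →
        ⊲-commˡ (⊲-assoc⁻ (⊲-resp-≈ ≈-refl ≈-refl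
          (≈-sym (+.identityʳ b)) (≈-sym (·.identityʳ a)) (x̄ x)))
    1⊑X+X̄ : 1G ⊑ (X +G compG X)
    1⊑X+X̄ = cl-least ⟨ 1# , 0# ⟩ (X +G compG X) λ where
      (lift refl) (u , v , _ , _ , w , w̄ , refl) →
        ⊲-assoc (⊲-resp-≈ (≈-sym (·.identityˡ v)) (≈-sym (+.identityˡ u)) ≈-refl ≈-refl
          (w̄ (▷⇒compG X w)))

  cl-⟨⟩-resp-≈ : a ≈ a' → b ≈ b' → cl ⟨ a , b ⟩ ⊑ cl ⟨ a' , b' ⟩
  cl-⟨⟩-resp-≈ {a' = a'} {b' = b'} a≈a' b≈b' = cl-least _ (cl ⟨ a' , b' ⟩) λ where
    (lift refl) → ∈-resp-≈ (cl ⟨ a' , b' ⟩) (⊆▷◁ (lift refl)) (≈-sym a≈a') (≈-sym b≈b')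

  cl-⟨⟩-cong : a ≈ a' → b ≈ b' → cl ⟨ a , b ⟩ ≐ cl ⟨ a' , b' ⟩
  cl-⟨⟩-cong a≈a' b≈b' = cl-⟨⟩-resp-≈ a≈a' b≈b' , cl-⟨⟩-resp-≈ (≈-sym a≈a') (≈-sym b≈b')

  ◁G-⟨⟩-resp-≈ : u ≈ u' → v ≈ v' → ◁G ⟨ u , v ⟩ ⊑ ◁G ⟨ u' , v' ⟩
  ◁G-⟨⟩-resp-≈ u≈u' v≈v' z (lift refl) = ⊲-resp-≈ ≈-refl ≈-refl u≈u' v≈v' (z (lift refl))

  ◁G-⟨⟩-cong : u ≈ u' → v ≈ v' → ◁G ⟨ u , v ⟩ ≐ ◁G ⟨ u' , v' ⟩
  ◁G-⟨⟩-cong u≈u' v≈v' = ◁G-⟨⟩-resp-≈ u≈u' v≈v' , ◁G-⟨⟩-resp-≈ (≈-sym u≈u') (≈-sym v≈v')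

  cl-⟨⟩-·G : ∀ a b a' b' → (cl ⟨ a , b ⟩ ·G cl ⟨ a' , b' ⟩) ≐ cl ⟨ a · a' , b + b' ⟩
  cl-⟨⟩-·G a b a' b' =
    ·G-least (cl ⟨ a , b ⟩) (cl ⟨ a' , b' ⟩) W (cl-⊗-⊆ W λ where
      (_ , _ , _ , _ , lift refl , lift refl , refl) → ⊆▷◁ (lift refl))
    , cl-least _ (cl ⟨ a , b ⟩ ·G cl ⟨ a' , b' ⟩) λ where
      (lift refl) → ∈·G (cl ⟨ a , b ⟩) (cl ⟨ a' , b' ⟩) (⊆▷◁ (lift refl)) (⊆▷◁ (lift refl))
    where W = cl ⟨ a · a' , b + b' ⟩

  ◁G-⟨⟩-+G : ∀ u v u' v' → (◁G ⟨ u , v ⟩ +G ◁G ⟨ u' , v' ⟩) ≐ ◁G ⟨ u + u' , v · v' ⟩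
  ◁G-⟨⟩-+G u v u' v' =
    (λ { z (lift refl) → z (mk⊕ {P = ⟨ u , v ⟩ ◁ ▷} {Q = ⟨ u' , v' ⟩ ◁ ▷}
                              (⊆◁▷ (lift refl)) (⊆◁▷ (lift refl))) })
    , +G-greatest (◁G ⟨ u , v ⟩) (◁G ⟨ u' , v' ⟩) (◁G ⟨ u + u' , v · v' ⟩)
        (◁▷-⊕-⊆ (⟨ u + u' , v · v' ⟩ ◁) λ where
          (_ , _ , _ , _ , lift refl , lift refl , refl) → ⊆◁▷ (lift refl))

  ∈eG : ∀ x → ⟦ eG x ⟧ (x , 0#)
  ∈eG x (lift refl) = ≤-resp₂ (≈-sym (·.identityʳ x)) (≈-sym (+.identityˡ x)) ≤-refl

  eG≐cl : ∀ x → eG x ≐ cl ⟨ x , 0# ⟩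
  eG≐cl x = (λ e w → ⊲-cut (e (lift refl)) (w (lift refl)))
          , cl-least _ (eG x) λ where (lift refl) → ∈eG x

  compG-eG≐◁G : ∀ x → compG (eG x) ≐ ◁G ⟨ 0# , x ⟩
  compG-eG≐◁G x = (λ { ē (lift refl) → ē (∈eG x) })
                , λ z e → ⊲-flip (⊲-cut (e (lift refl)) (⊲-flip (z (lift refl))))

  compG-eG≐cl : ∀ x → compG (eG x) ≐ cl ⟨ 1# , x ⟩
  compG-eG≐cl x = (λ ē w → ⊲-flip (⊲-cut (⊲-flip (w (lift refl))) (⊲-flip (ē (∈eG x)))))
                , cl-least _ (compG (eG x)) λ where (lift refl) e → ⊲-flip (e (lift refl))

  eG-mono : x ≤ y → eG x ⊑ eG y
  eG-mono x≤y e (lift refl) = ≤-trans (e (lift refl)) (+-mono ≤-refl x≤y)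

  eG-reflects-≤ : ∀ {x y} → eG x ⊑ eG y → x ≤ y
  eG-reflects-≤ {x} {y} ex⊑ey =
    ≤-resp₂ (·.identityʳ x) (+.identityˡ y) (ex⊑ey (∈eG x) (lift refl))

  eG-·-hom : ∀ x y → eG (x · y) ≐ (eG x ·G eG y)
  eG-·-hom x y = begin
    eG (x · y)                        ≈⟨ eG≐cl (x · y) ⟩
    cl ⟨ x · y , 0# ⟩                 ≈⟨ cl-⟨⟩-cong ≈-refl (+.identityˡ 0#) ⟨
    cl ⟨ x · y , 0# + 0# ⟩            ≈⟨ cl-⟨⟩-·G x 0# y 0# ⟨
    cl ⟨ x , 0# ⟩ ·G cl ⟨ y , 0# ⟩    ≈⟨ ·G-cong {eG x} {cl ⟨ x , 0# ⟩} {eG y} {cl ⟨ y , 0# ⟩}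
                                           (eG≐cl x) (eG≐cl y) ⟨
    eG x ·G eG y                      ∎
    where open ≐-Reasoning

  eG-+-hom : ∀ x y → eG (x + y) ≐ (eG x +G eG y)
  eG-+-hom x y = begin
    eG (x + y)                ≈⟨ ◁G-⟨⟩-cong ≈-refl (·.identityˡ 1#) ⟨
    ◁G ⟨ x + y , 1# · 1# ⟩    ≈⟨ ◁G-⟨⟩-+G x 1# y 1# ⟨
    eG x +G eG y              ∎
    where open ≐-Reasoning

  eG-isEmbedding : IsEmbedding A G-commBimonoid eG
  eG-isEmbedding = record
    { isHomomorphism = record
      { mono  = eG-mono
      ; ·-hom = eG-·-hom
      ; 1-hom = eG≐cl 1#
      ; +-hom = eG-+-hom
      ; 0-hom = ≐-refl {eG 0#}
      }
    ; order-reflect = eG-reflects-≤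
    }

  cl-⟨⟩≐eG·compG : ∀ a b → cl ⟨ a , b ⟩ ≐ (eG a ·G compG (eG b))
  cl-⟨⟩≐eG·compG a b = begin
    cl ⟨ a , b ⟩                     ≈⟨ cl-⟨⟩-cong (·.identityʳ a) (+.identityˡ b) ⟨
    cl ⟨ a · 1# , 0# + b ⟩           ≈⟨ cl-⟨⟩-·G a 0# 1# b ⟨
    cl ⟨ a , 0# ⟩ ·G cl ⟨ 1# , b ⟩   ≈⟨ ·G-cong {eG a} {cl ⟨ a , 0# ⟩} {compG (eG b)} {cl ⟨ 1# , b ⟩}
                                          (eG≐cl a) (compG-eG≐cl b) ⟨
    eG a ·G compG (eG b)             ∎
    where open ≐-Reasoning

  ◁G-⟨⟩≐eG+compG : ∀ u v → ◁G ⟨ u , v ⟩ ≐ (eG u +G compG (eG v))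
  ◁G-⟨⟩≐eG+compG u v = begin
    ◁G ⟨ u , v ⟩                     ≈⟨ ◁G-⟨⟩-cong (+.identityʳ u) (·.identityˡ v) ⟨
    ◁G ⟨ u + 0# , 1# · v ⟩           ≈⟨ ◁G-⟨⟩-+G u 1# 0# v ⟨
    ◁G ⟨ u , 1# ⟩ +G ◁G ⟨ 0# , v ⟩   ≈⟨ +G-cong {eG u} {eG u} {compG (eG v)} {◁G ⟨ 0# , v ⟩}
                                          (≐-refl {eG u}) (compG-eG≐◁G v) ⟨
    eG u +G compG (eG v)             ∎
    where open ≐-Reasoning

  eG-joinDense : JoinDense A G-commBimonoid eG
  eG-joinDense X Z below {a , b} x =
    below a b (compG (eG b)) (compG-isComplement (eG b))
      (λ m → cl-least _ X (λ where (lift refl) → x) (proj₂ (cl-⟨⟩≐eG·compG a b) m))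
      (proj₁ (cl-⟨⟩≐eG·compG a b) (⊆▷◁ (lift refl)))

  eG-meetDense : MeetDense A G-commBimonoid eG
  eG-meetDense X Z above z = closed X λ {u} {v} w →
    proj₂ (◁G-⟨⟩≐eG+compG u v)
      (above u v (compG (eG v)) (compG-isComplement (eG v))
        (λ x → proj₁ (◁G-⟨⟩≐eG+compG u v) λ where (lift refl) → w x)
        z)
      (lift refl)

  G-isComplete : IsComplete G-commBimonoid p
  G-isComplete I X = (⋁ , ⋁-isSup) , (⋀ , ⋀-isInf)
    where
    ⋃X : Pred A² p
    ⋃X z = ∃[ i ] ⟦ X i ⟧ z
    ⋁ : G
    ⋁ = cl ⋃X
    ⋁-isSup : IsSup G-commBimonoid X ⋁
    ⋁-isSup = (λ i x → ⊆▷◁ (i , x))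
            , λ U X⊑U → cl-least ⋃X U λ (i , x) → X⊑U i x
    ⋀ : G
    ⋀ = (λ z → ∀ i → ⟦ X i ⟧ z) , ⊆▷◁ , λ z i → closed (X i) λ w → z λ x → w (x i)
    ⋀-isInf : IsInf G-commBimonoid X ⋀
    ⋀-isInf = (λ i x → x i) , λ U U⊑X u i → U⊑X i u

  G-isLattice : IsLattice _≐_ _⊑_ _∨G_ _∧G_
  G-isLattice = record
    { isPartialOrder = ⊑-isPartialOrder
    ; supremum       = λ X Y →
        (λ x → ⊆▷◁ (inj₁ x)) , (λ y → ⊆▷◁ (inj₂ y)) , λ Z X⊑Z Y⊑Z →
          cl-least _ Z λ where (inj₁ x) → X⊑Z x
                               (inj₂ y) → Y⊑Z y
    ; infimum        = λ X Y → proj₁ , proj₂ , λ Z Z⊑X Z⊑Y z → Z⊑X z , Z⊑Y z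
    }

  module G-lattice = IsLattice G-isLattice

  ·G-distrib-∨G : ∀ X Y Z → (X ·G (Y ∨G Z)) ≐ ((X ·G Y) ∨G (X ·G Z))
  ·G-distrib-∨G X Y Z =
      ·G-least X (Y ∨G Z) W (cl-⊗ʳ-⊆ W λ where
        (_ , _ , _ , _ , x , inj₁ y , refl) → G-lattice.x≤x∨y (X ·G Y) (X ·G Z) (∈·G X Y x y)
        (_ , _ , _ , _ , x , inj₂ z , refl) → G-lattice.y≤x∨y (X ·G Y) (X ·G Z) (∈·G X Z x z))
    , cl-least _ (X ·G (Y ∨G Z)) λ where
        (inj₁ m) → ·G-mono {X} {X} {Y} {Y ∨G Z} (λ x → x) (G-lattice.x≤x∨y Y Z) m
        (inj₂ m) → ·G-mono {X} {X} {Z} {Y ∨G Z} (λ x → x) (G-lattice.y≤x∨y Y Z) m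
    where W = (X ·G Y) ∨G (X ·G Z)

  +G-distrib-∧G : ∀ X Y Z → (X +G (Y ∧G Z)) ≐ ((X +G Y) ∧G (X +G Z))
  +G-distrib-∧G X Y Z =
      (λ m → +G-mono {X} {X} {Y ∧G Z} {Y} (λ x → x) (G-lattice.x∧y≤x Y Z) m
           , +G-mono {X} {X} {Y ∧G Z} {Z} (λ x → x) (G-lattice.x∧y≤y Y Z) m)
    , +G-greatest X (Y ∧G Z) W λ where
        (_ , _ , _ , _ , x , yz , refl) →
          ◁▷-⊕ʳ-⊆ ⟦ W ⟧ ⊕∪⊆W▷ (mk⊕ {P = ⟦ X ⟧ ▷} {Q = (⟦ Y ⟧ ▷ ∪ ⟦ Z ⟧ ▷) ◁ ▷} x
            λ y▷∪z▷ → yz (closed Y (λ y → y▷∪z▷ (inj₁ y)) , closed Z (λ z → y▷∪z▷ (inj₂ z))))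
    where
    W = (X +G Y) ∧G (X +G Z)
    ⊕∪⊆W▷ : ⟦ X ⟧ ▷ ⊕ (⟦ Y ⟧ ▷ ∪ ⟦ Z ⟧ ▷) ⊆ ⟦ W ⟧ ▷
    ⊕∪⊆W▷ (_ , _ , _ , _ , x , inj₁ y , refl) (m , _) = ∈+G▷ X Y x y m
    ⊕∪⊆W▷ (_ , _ , _ , _ , x , inj₂ z , refl) (_ , m) = ∈+G▷ X Z x z m

  G-isℓExtension : IsℓExtension G-commBimonoid _∨G_ _∧G_
  G-isℓExtension = record
    { isLattice   = G-isLattice
    ; ·-distrib-∨ = ·G-distrib-∨G
    ; +-distrib-∧ = +G-distrib-∧G
    }

  module _ (L : ℓExtension A) where
    open ℓExtension L
    open IsLattice isLattice using (x≤x∨y; y≤x∨y; ∨-least; x∧y≤x; x∧y≤y; ∧-greatest)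

    ⊲-∨ : ∀ {x y b u v} → (x , b) ⊲ (u , v) → (y , b) ⊲ (u , v) → (x ∨ y , b) ⊲ (u , v)
    ⊲-∨ {x} {y} {b} {u} {v} x⊲uv y⊲uv = begin
      (x ∨ y) · v          ≈⟨ ·.comm (x ∨ y) v ⟩
      v · (x ∨ y)          ≈⟨ ·-distrib-∨ v x y ⟩
      (v · x) ∨ (v · y)    ≤⟨ ∨-least (≤-respˡ-≈ (·.comm x v) x⊲uv)
                                      (≤-respˡ-≈ (·.comm y v) y⊲uv) ⟩
      b + u                ∎
      where open ≤-Reasoning

    ⊲-∧ : ∀ {a b x y v} → (a , b) ⊲ (x , v) → (a , b) ⊲ (y , v) → (a , b) ⊲ (x ∧ y , v)
    ⊲-∧ {b = b} {x} {y} a⊲x a⊲y =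
      ≤-respʳ-≈ (≈-sym (+-distrib-∧ b x y)) (∧-greatest a⊲x a⊲y)

    eG-∨-hom : ∀ x y → eG (x ∨ y) ≐ (eG x ∨G eG y)
    eG-∨-hom x y =
        (λ e w → ⊲-cut (e (lift refl)) (⊲-∨ (w (inj₁ (∈eG x))) (w (inj₂ (∈eG y)))))
      , cl-least _ (eG (x ∨ y)) λ where
          (inj₁ e) → eG-mono (x≤x∨y x y) e
          (inj₂ e) → eG-mono (y≤x∨y x y) e

    eG-∧-hom : ∀ x y → eG (x ∧ y) ≐ (eG x ∧G eG y)
    eG-∧-hom x y =
        (λ e → eG-mono (x∧y≤x x y) e , eG-mono (x∧y≤y x y) e)
      , λ { (ex , ey) (lift refl) → ⊲-∧ (ex (lift refl)) (ey (lift refl)) }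

mainTheorem8 : ∀ {c ℓ₁ ℓ₂} (A : CommBimonoid c ℓ₁ ℓ₂) →
    let open Construction A in
    Σ[ isB ∈ IsCommBimonoid _≐_ _⊑_ _·G_ 1G _+G_ 0G ]
      ( IsComplementedDMCompletion A (GBimonoid isB) p eG
      × IsLattice _≐_ _⊑_ _∨G_ _∧G_
      × (∀ X → IsComplement (GBimonoid isB) X (compG X))
      × (∀ (L : ℓExtension A) →
           IsℓExtension (GBimonoid isB) _∨G_ _∧G_
           × (∀ x y → eG (ℓExtension._∨_ L x y) ≐ (eG x ∨G eG y))
           × (∀ x y → eG (ℓExtension._∧_ L x y) ≐ (eG x ∧G eG y))) )
mainTheorem8 A =
    G-isCommBimonoid
  , record
    { isΔ₁Extension = record
      { isEmbedding = eG-isEmbedding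
      ; joinDense   = eG-joinDense
      ; meetDense   = eG-meetDense
      }
    ; complete      = G-isComplete
    ; complemented  = λ X → compG X , compG-isComplement X
    }
  , G-isLattice
  , compG-isComplement
  , λ L → G-isℓExtension , eG-∨-hom L , eG-∧-hom L
  where
  open Construction A
  open Completion A
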